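{- Let $(\mathcal{Q},\mathcal{P})$ be a bipartite monoid with reduction $(\mathcal{Q}',\mathcal{P}')$ and projection $\pi:\mathcal{Q}\to\mathcal{Q}'$. Let $f:(\mathcal{Q},\mathcal{P})\to(\mathcal{S},\mathcal{R})$ be a surjective bipartite monoid homomorphism, and let $(\mathcal{S}',\mathcal{R}')$ be the reduction of $(\mathcal{S},\mathcal{R})$ with projection $\sigma:\mathcal{S}\to\mathcal{S}'$. Then there is an isomorphism of bipartite monoids $i:(\mathcal{Q}',\mathcal{P}')\to(\mathcal{S}',\mathcal{R}')$ with $i\circ\pi=\sigma\circ f$.
   Context: A bipartite monoid is a pair $(\mathcal{Q},\mathcal{P})$ where $\mathcal{Q}$ is a commutative monoid and $\mathcal{P}\subseteq\mathcal{Q}$. A bipartite monoid homomorphism $f:(\mathcal{Q},\mathcal{P})\to(\mathcal{S},\mathcal{R})$ is a monoid homomorphism $\mathcal{Q}\to\mathcal{S}$ such that for all $x\in\mathcal{Q}$, $x\in\mathcal{P}$ iff $f(x)\in\mathcal{R}$; an isomorphism is a bijective such homomorphism. Elements $x,y\in\mathcal{Q}$ are indistinguishable if for all $z\in\mathcal{Q}$, $xz\in\mathcal{P}\iff yz\in\mathcal{P}$; this is an equivalence relation $\rho$ compatible with multiplication. The reduction of $(\mathcal{Q},\mathcal{P})$ is $(\mathcal{Q}/\rho,\ \{[x]_\rho : x\in\mathcal{P}\})$ with the induced multiplication, and $\pi(x)=[x]_\rho$. -}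

module Defs where

open import Level using (Level; _⊔_) renaming (suc to lsuc)
open import Algebra.Bundles using (CommutativeMonoid)
open import Algebra.Structures using (IsCommutativeMonoid)
open import Algebra.Morphism.Structures using (module MonoidMorphisms)
open import Data.Product using (_×_; _,_; proj₁; proj₂; ∃)
open import Relation.Unary using (Pred)
open import Relation.Binary.Core using (Rel)
open import Relation.Binary.Definitions using (_Respects_)

record BipartiteMonoid (c ℓ p : Level) : Set (lsuc (c ⊔ ℓ ⊔ p)) where
  field
    commMonoid : CommutativeMonoid c ℓ
  open CommutativeMonoid commMonoid public
  field
    P      : Pred Carrier p
    P-resp : P Respects _≈_

module _ {c ℓ p c' ℓ' p'} (A : BipartiteMonoid c ℓ p) (B : BipartiteMonoid c' ℓ' p') where
  private
    module A = BipartiteMonoid A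
    module B = BipartiteMonoid B
    module MM = MonoidMorphisms A.rawMonoid B.rawMonoid

  IsBipartiteHomomorphism : (A.Carrier → B.Carrier) → Set (c ⊔ ℓ ⊔ ℓ' ⊔ p ⊔ p')
  IsBipartiteHomomorphism f =
    MM.IsMonoidHomomorphism f × (∀ x → (A.P x → B.P (f x)) × (B.P (f x) → A.P x))

  IsBipartiteIsomorphism : (A.Carrier → B.Carrier) → Set (c ⊔ c' ⊔ ℓ ⊔ ℓ' ⊔ p ⊔ p')
  IsBipartiteIsomorphism f =
    MM.IsMonoidIsomorphism f × (∀ x → (A.P x → B.P (f x)) × (B.P (f x) → A.P x))

module Reduction {c ℓ p} (A : BipartiteMonoid c ℓ p) where
  open BipartiteMonoid A

  Indist : Rel Carrier (c ⊔ p)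
  Indist x y = ∀ z → (P (x ∙ z) → P (y ∙ z)) × (P (y ∙ z) → P (x ∙ z))

  private
    ρ-refl : ∀ {x} → Indist x x
    ρ-refl z = (λ h → h) , (λ h → h)

    ρ-sym : ∀ {x y} → Indist x y → Indist y x
    ρ-sym h z = proj₂ (h z) , proj₁ (h z)

    ρ-trans : ∀ {x y w} → Indist x y → Indist y w → Indist x w
    ρ-trans h k z = (λ q → proj₁ (k z) (proj₁ (h z) q)) , (λ q → proj₂ (h z) (proj₂ (k z) q))

    ≈⇒ρ : ∀ {x y} → x ≈ y → Indist x y
    ≈⇒ρ e z = P-resp (∙-congʳ e) , P-resp (∙-congʳ (sym e))

    ρ-congʳ : ∀ {x y} u → Indist x y → Indist (x ∙ u) (y ∙ u)
    ρ-congʳ {x} {y} u h z =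
      (λ q → P-resp (sym (assoc y u z)) (proj₁ (h (u ∙ z)) (P-resp (assoc x u z) q))) ,
      (λ q → P-resp (sym (assoc x u z)) (proj₂ (h (u ∙ z)) (P-resp (assoc y u z) q)))

    ρ-cong : ∀ {x y u v} → Indist x y → Indist u v → Indist (x ∙ u) (y ∙ v)
    ρ-cong {x} {y} {u} {v} h k =
      ρ-trans (ρ-congʳ u h)
        (ρ-trans (≈⇒ρ (comm y u))
          (ρ-trans (ρ-congʳ y k) (≈⇒ρ (comm v y))))

    isCM : IsCommutativeMonoid Indist _∙_ ε
    isCM = record
      { isMonoid = record
        { isSemigroup = record
          { isMagma = record
            { isEquivalence = record { refl = ρ-refl ; sym = ρ-sym ; trans = ρ-trans }
            ; ∙-cong = ρ-cong }
          ; assoc = λ x y z → ≈⇒ρ (assoc x y z) }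
        ; identity = (λ x → ≈⇒ρ (identityˡ x)) , (λ x → ≈⇒ρ (identityʳ x)) }
      ; comm = λ x y → ≈⇒ρ (comm x y) }

  -- P' = { [x]ρ : x ∈ P }, i.e. [x] ∈ P' iff x is ρ-related to some y ∈ P
  P' : Pred Carrier (c ⊔ p)
  P' x = ∃ λ y → P y × Indist x y

  -- The reduction (Q/ρ , P'), with Q/ρ represented as the setoid (Q , ρ).
  reduction : BipartiteMonoid c (c ⊔ p) (c ⊔ p)
  reduction = record
    { commMonoid = record { Carrier = Carrier ; _≈_ = Indist ; _∙_ = _∙_ ; ε = ε ; isCommutativeMonoid = isCM }
    ; P = P'
    ; P-resp = λ {x} {w} h (y , py , r) → y , py , ρ-trans (ρ-sym h) r }

  projection : Carrier → BipartiteMonoid.Carrier reduction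
  projection x = x

{-# OPTIONS --safe #-}
module Submission where

-- Since f is surjective, indistinguishability in S only has to be tested
-- against images f z, and f x ∙ f z ∈ R iff x ∙ z ∈ P.  Hence x ρ y iff
-- f x ρ f y: f itself is well defined and injective on the reductions, and
-- surjective because f is.  The subsets match because testing against ε
-- shows that [x] ∈ P' iff x ∈ P.

open import Defs
open import Data.Product using (_×_; ∃; _,_; proj₁; proj₂)
open import Function.Base using (_∘_)
open import Function.Definitions using (Surjective)
open import Algebra.Morphism.Structures using (module MonoidMorphisms)

module ReductionProperties {c ℓ p} (A : BipartiteMonoid c ℓ p) where
  open BipartiteMonoid A
  open Reduction A using (Indist; P'; reduction)

  ≈⇒Indist : ∀ {x y} → x ≈ y → Indist x y
  ≈⇒Indist x≈y z = P-resp (∙-congʳ x≈y) , P-resp (∙-congʳ (sym x≈y))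

  P'⇒P : ∀ {x} → P' x → P x
  P'⇒P {x} (y , Py , x∼y) =
    P-resp (identityʳ x) (proj₂ (x∼y ε) (P-resp (sym (identityʳ y)) Py))

  P⇒P' : ∀ {x} → P x → P' x
  P⇒P' {x} Px = x , Px , BipartiteMonoid.refl reduction

module BipartiteHomomorphismProperties
    {c ℓ p c' ℓ' p'} (Q : BipartiteMonoid c ℓ p) (S : BipartiteMonoid c' ℓ' p')
    (f : BipartiteMonoid.Carrier Q → BipartiteMonoid.Carrier S)
    (hom : IsBipartiteHomomorphism Q S f) where
  private
    module Q = BipartiteMonoid Q
    module S = BipartiteMonoid S
    module Q' = BipartiteMonoid (Reduction.reduction Q)
    module S' = BipartiteMonoid (Reduction.reduction S)
    module H = MonoidMorphisms.IsMonoidHomomorphism (proj₁ hom)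
    open MonoidMorphisms Q'.rawMonoid S'.rawMonoid using (IsMonoidIsomorphism)
    open ReductionProperties

  P-preserved : ∀ {x} → Q.P x → S.P (f x)
  P-preserved {x} = proj₁ (proj₂ hom x)

  P-reflected : ∀ {x} → S.P (f x) → Q.P x
  P-reflected {x} = proj₂ (proj₂ hom x)

  P-∙-preserved : ∀ x z → Q.P (x Q.∙ z) → S.P (f x S.∙ f z)
  P-∙-preserved x z = S.P-resp (H.homo x z) ∘ P-preserved

  P-∙-reflected : ∀ x z → S.P (f x S.∙ f z) → Q.P (x Q.∙ z)
  P-∙-reflected x z = P-reflected ∘ S.P-resp (S.sym (H.homo x z))

  Indist-reflected : ∀ {x y} → f x S'.≈ f y → x Q'.≈ y
  Indist-reflected {x} {y} fx∼fy z =
    P-∙-reflected y z ∘ proj₁ (fx∼fy (f z)) ∘ P-∙-preserved x z ,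
    P-∙-reflected x z ∘ proj₂ (fx∼fy (f z)) ∘ P-∙-preserved y z

  reduced-P-preserved : ∀ x → (Q'.P x → S'.P (f x)) × (S'.P (f x) → Q'.P x)
  reduced-P-preserved x =
    P⇒P' S ∘ P-preserved ∘ P'⇒P Q ,
    P⇒P' Q ∘ P-reflected ∘ P'⇒P S

  module _ (surj : Surjective Q._≈_ S._≈_ f) where

    Indist-preserved : ∀ {x y} → x Q'.≈ y → f x S'.≈ f y
    Indist-preserved {x} {y} x∼y w = transfer (proj₁ (x∼y z)) , transfer (proj₂ (x∼y z))
      where
        z : Q.Carrier
        z = proj₁ (surj w)

        fz≈w : f z S.≈ w
        fz≈w = proj₂ (surj w) Q.refl

        transfer : ∀ {a b} → (Q.P (a Q.∙ z) → Q.P (b Q.∙ z)) → S.P (f a S.∙ w) → S.P (f b S.∙ w)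
        transfer {a} {b} t =
          S.P-resp (S.∙-congˡ fz≈w) ∘ P-∙-preserved b z ∘ t ∘
          P-∙-reflected a z ∘ S.P-resp (S.∙-congˡ (S.sym fz≈w))

    reduced-isMonoidIsomorphism : IsMonoidIsomorphism f
    reduced-isMonoidIsomorphism = record
      { isMonoidMonomorphism = record
        { isMonoidHomomorphism = record
          { isMagmaHomomorphism = record
            { isRelHomomorphism = record { cong = Indist-preserved }
            ; homo = λ x y → ≈⇒Indist S (H.homo x y)
            }
          ; ε-homo = ≈⇒Indist S H.ε-homo
          }
        ; injective = Indist-reflected
        }
      ; surjective = λ w → proj₁ (surj w) , λ z∼x →
          S'.trans (Indist-preserved z∼x) (≈⇒Indist S (proj₂ (surj w) Q.refl))
      }

mainTheorem9 : ∀ {c ℓ p c' ℓ' p'} (Q : BipartiteMonoid c ℓ p) (S : BipartiteMonoid c' ℓ' p')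
    (f : BipartiteMonoid.Carrier Q → BipartiteMonoid.Carrier S) →
    IsBipartiteHomomorphism Q S f →
    Surjective (BipartiteMonoid._≈_ Q) (BipartiteMonoid._≈_ S) f →
    ∃ λ (i : BipartiteMonoid.Carrier (Reduction.reduction Q) → BipartiteMonoid.Carrier (Reduction.reduction S)) →
      IsBipartiteIsomorphism (Reduction.reduction Q) (Reduction.reduction S) i ×
      (∀ x → BipartiteMonoid._≈_ (Reduction.reduction S) (i (Reduction.projection Q x)) (Reduction.projection S (f x)))
mainTheorem9 Q S f hom surj =
  f , (reduced-isMonoidIsomorphism surj , reduced-P-preserved) ,
  λ _ → BipartiteMonoid.refl (Reduction.reduction S)
  where open BipartiteHomomorphismProperties Q S f hom
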